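{- Let $q$ and $q+1$ both be prime powers, let $X=\mathbb{F}_{q+1}\times\mathbb{F}_q\times\mathbb{F}_q$ with its additive group structure, and consider the commutative association scheme on $X$ with adjacency matrices $A_0=I_{(q+1)q^2}$, $A_1=I_{q+1}\otimes I_q\otimes(J_q-I_q)$, $A_2=I_{q+1}\otimes(J_q-I_q)\otimes J_q$, $A_3=(J_{q+1}-I_{q+1})\otimes I_{q^2}$, $A_4=(J_{q+1}-I_{q+1})\otimes I_q\otimes(J_q-I_q)$, $A_{5,\beta}=N_\beta-A_3$ ($\beta\in\mathbb{F}_{q+1}^*$), with $N_\beta$ as in the context. Then this scheme is a translation association scheme: for each of its relations $R$ (the set of pairs $(u,v)\in X\times X$ where the corresponding adjacency matrix has entry $1$) and all $u,v,z\in X$, $(u,v)\in R$ implies $(u+z,v+z)\in R$.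
   Context: $I_n,J_n$ are the identity and all-ones matrices of order $n$, $\mathbb{F}_r^*=\mathbb{F}_r\setminus\{0\}$, $\otimes$ is the Kronecker product. Let $x$ be a new symbol and fix a bijection $\varphi:\mathbb{F}_{q+1}\to\mathbb{F}_q\cup\{x\}$ with $\varphi(0)=x$. Matrices of order $(q+1)q^2$ have rows and columns indexed by $X$ in lexicographic order (compatible with Kronecker products). For $\beta\in\mathbb{F}_{q+1}^*$, $N_\beta$ is the $(0,1)$-matrix whose $((b,a_1,a_2),(b',a_1',a_2'))$-entry is $1$ if $c=\varphi(\beta(b'-b))$ lies in $\mathbb{F}_q$ and $a_2'-a_2=c(a_1'-a_1)$, and $0$ otherwise. These matrices form a commutative association scheme with $q+4$ classes. -}

module Defs where

open import Level using (0ℓ)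
open import Data.Nat using (ℕ; _^_; _≥_)
open import Data.Nat.Primality using (Prime)
open import Data.Fin using (Fin)
open import Data.Product using (Σ; ∃; _×_; _,_)
open import Data.Maybe using (Maybe; just; nothing)
open import Data.Maybe.Relation.Binary.Pointwise using (Pointwise)
import Data.Maybe.Relation.Binary.Pointwise as MaybeP
open import Relation.Nullary using (¬_)
open import Relation.Binary.PropositionalEquality using (_≡_)
import Relation.Binary.PropositionalEquality as ≡
open import Algebra.Bundles using (CommutativeRing)
open import Function.Bundles using (Inverse)

IsPrimePower : ℕ → Set
IsPrimePower n = Σ ℕ λ p → Σ ℕ λ k → Prime p × k ≥ 1 × n ≡ p ^ k

record IsField (R : CommutativeRing 0ℓ 0ℓ) : Set where
  open CommutativeRing R
  field
    0≉1     : ¬ (0# ≈ 1#)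
    inverse : ∀ x → ¬ (x ≈ 0#) → Σ Carrier λ y → x * y ≈ 1#

record FiniteField (n : ℕ) : Set₁ where
  field
    cring    : CommutativeRing 0ℓ 0ℓ
    isField  : IsField cring
    counting : Inverse (CommutativeRing.setoid cring) (≡.setoid (Fin n))
  open CommutativeRing cring public

-- The setting: fields K = F_{q+1}, F = F_q, and the bijection φ : K → F ∪ {x},
-- with F ∪ {x} modelled as Maybe F (x = nothing); φ is a setoid bijection.
module Scheme {q : ℕ} (F : FiniteField q) (K : FiniteField (ℕ.suc q))
              (φ-bij : Inverse (FiniteField.setoid K)
                               (MaybeP.setoid (FiniteField.setoid F))) where

  private
    module F = FiniteField F
    module K = FiniteField K

  φ : K.Carrier → Maybe F.Carrier
  φ = Inverse.to φ-bij

  X : Set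
  X = K.Carrier × F.Carrier × F.Carrier

  _⊕_ : X → X → X
  (b , a₁ , a₂) ⊕ (b' , a₁' , a₂') = (b K.+ b') , (a₁ F.+ a₁') , (a₂ F.+ a₂')

  N : K.Carrier → X → X → Set
  N β (b , a₁ , a₂) (b' , a₁' , a₂') =
    Σ F.Carrier λ c →
      Pointwise F._≈_ (φ (β K.* (b' K.- b))) (just c) ×
      (a₂' F.- a₂) F.≈ c F.* (a₁' F.- a₁)

  data Class : Set where
    c0 c1 c2 c3 c4 : Class
    c5 : (β : K.Carrier) → ¬ (β K.≈ K.0#) → Class

  -- R i u v : entry (u,v) of A_i is 1
  -- A₀ = I, A₁ = I⊗I⊗(J−I), A₂ = I⊗(J−I)⊗J, A₃ = (J−I)⊗I⊗I,
  -- A₄ = (J−I)⊗I⊗(J−I), A_{5,β} = N_β − A₃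
  R : Class → X → X → Set
  R c0 (b , a₁ , a₂) (b' , a₁' , a₂') = b K.≈ b' × a₁ F.≈ a₁' × a₂ F.≈ a₂'
  R c1 (b , a₁ , a₂) (b' , a₁' , a₂') = b K.≈ b' × a₁ F.≈ a₁' × ¬ (a₂ F.≈ a₂')
  R c2 (b , a₁ , a₂) (b' , a₁' , a₂') = b K.≈ b' × ¬ (a₁ F.≈ a₁')
  R c3 (b , a₁ , a₂) (b' , a₁' , a₂') = ¬ (b K.≈ b') × a₁ F.≈ a₁' × a₂ F.≈ a₂'
  R c4 (b , a₁ , a₂) (b' , a₁' , a₂') = ¬ (b K.≈ b') × a₁ F.≈ a₁' × ¬ (a₂ F.≈ a₂')
  R (c5 β _) u v = N β u v × ¬ R c3 u v

-- Every relation is a conjunction of conditions of two kinds, read off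
-- coordinatewise on the pair (u , v):
--   * (in)equalities b ≈ b', ¬ (a ≈ a') between corresponding coordinates;
--   * conditions on the differences b' - b, a₁' - a₁, a₂' - a₂ (the matrix N_β).
-- Both kinds are translation invariant in any abelian group: adding z to both
-- sides preserves and reflects equality, and (x + z) - (y + z) ≈ x - y.
module Submission where

open import Defs
open import Data.Nat using (ℕ; suc)
open import Data.Maybe using (nothing; just)
open import Data.Maybe.Relation.Binary.Pointwise using (Pointwise; setoid)
open import Function.Bundles using (Inverse)
open import Data.Product using (_,_)
open import Relation.Nullary using (¬_)
open import Algebra.Bundles using (AbelianGroup)
open import Relation.Binary.Bundles using (Setoid)
import Algebra.Properties.AbelianGroup as AbelianGroupProperties
import Relation.Binary.Reasoning.Setoid as SetoidReasoning

module Translation {a ℓ} (G : AbelianGroup a ℓ) where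
  open AbelianGroup G
  open AbelianGroupProperties G using (⁻¹-anti-homo-∙; ∙-cancelʳ)
  open SetoidReasoning (AbelianGroup.setoid G)

  translate-≈ : ∀ {x y} z → x ≈ y → x ∙ z ≈ y ∙ z
  translate-≈ z = ∙-congʳ

  untranslate-≈ : ∀ {x y} z → x ∙ z ≈ y ∙ z → x ≈ y
  untranslate-≈ z = ∙-cancelʳ z _ _

  translate-≉ : ∀ {x y} z → ¬ x ≈ y → ¬ x ∙ z ≈ y ∙ z
  translate-≉ z x≉y = λ x+z≈y+z → x≉y (untranslate-≈ z x+z≈y+z)

  translate-difference : ∀ x y z → (x ∙ z) ∙ (y ∙ z) ⁻¹ ≈ x ∙ y ⁻¹
  translate-difference x y z = begin
    (x ∙ z) ∙ (y ∙ z) ⁻¹     ≈⟨ ∙-congˡ (⁻¹-anti-homo-∙ y z) ⟩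
    (x ∙ z) ∙ (z ⁻¹ ∙ y ⁻¹)  ≈⟨ assoc x z _ ⟩
    x ∙ (z ∙ (z ⁻¹ ∙ y ⁻¹))  ≈⟨ ∙-congˡ (assoc z (z ⁻¹) (y ⁻¹)) ⟨
    x ∙ ((z ∙ z ⁻¹) ∙ y ⁻¹)  ≈⟨ ∙-congˡ (∙-congʳ (inverseʳ z)) ⟩
    x ∙ (ε ∙ y ⁻¹)           ≈⟨ ∙-congˡ (identityˡ (y ⁻¹)) ⟩
    x ∙ y ⁻¹                 ∎

module SchemeTranslation {q : ℕ} (F : FiniteField q) (K : FiniteField (suc q))
    (φ-bij : Inverse (FiniteField.setoid K) (setoid (FiniteField.setoid F))) where
  private
    module F = FiniteField F
    module K = FiniteField K
    module TF = Translation F.+-abelianGroup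
    module TK = Translation K.+-abelianGroup
  open Scheme F K φ-bij

  -- N_β only depends on the differences of the coordinates, so it is
  -- translation invariant.
  N-translate : ∀ β u v z → N β u v → N β (u ⊕ z) (v ⊕ z)
  N-translate β (b , a₁ , a₂) (b' , a₁' , a₂') (t , s₁ , s₂) (c , φ≈c , slope) =
    c , φ≈c′ , slope′
    where
    φ≈c′ : Pointwise F._≈_ (φ (β K.* ((b' K.+ t) K.- (b K.+ t)))) (just c)
    φ≈c′ = Setoid.trans (setoid F.setoid)
             (Inverse.to-cong φ-bij (K.*-congˡ (TK.translate-difference b' b t)))
             φ≈c
    slope′ : ((a₂' F.+ s₂) F.- (a₂ F.+ s₂)) F.≈ c F.* ((a₁' F.+ s₁) F.- (a₁ F.+ s₁))
    slope′ = F.trans (TF.translate-difference a₂' a₂ s₂)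
               (F.trans slope (F.*-congˡ (F.sym (TF.translate-difference a₁' a₁ s₁))))

  -- A₃ is reflected by translation; this gives invariance of the
  -- negated conjunct ¬ A₃ in A_{5,β} = N_β − A₃.
  R₃-untranslate : ∀ u v z → R c3 (u ⊕ z) (v ⊕ z) → R c3 u v
  R₃-untranslate (b , a₁ , a₂) (b' , a₁' , a₂') (t , s₁ , s₂) (b≉b' , a₁≈a₁' , a₂≈a₂') =
    (λ b≈b' → b≉b' (TK.translate-≈ t b≈b')) ,
    TF.untranslate-≈ s₁ a₁≈a₁' ,
    TF.untranslate-≈ s₂ a₂≈a₂'

  R-translate : ∀ i u v z → R i u v → R i (u ⊕ z) (v ⊕ z)
  R-translate c0 _ _ (t , s₁ , s₂) (b≈ , a₁≈ , a₂≈) =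
    TK.translate-≈ t b≈ , TF.translate-≈ s₁ a₁≈ , TF.translate-≈ s₂ a₂≈
  R-translate c1 _ _ (t , s₁ , s₂) (b≈ , a₁≈ , a₂≉) =
    TK.translate-≈ t b≈ , TF.translate-≈ s₁ a₁≈ , TF.translate-≉ s₂ a₂≉
  R-translate c2 _ _ (t , s₁ , s₂) (b≈ , a₁≉) =
    TK.translate-≈ t b≈ , TF.translate-≉ s₁ a₁≉
  R-translate c3 _ _ (t , s₁ , s₂) (b≉ , a₁≈ , a₂≈) =
    TK.translate-≉ t b≉ , TF.translate-≈ s₁ a₁≈ , TF.translate-≈ s₂ a₂≈
  R-translate c4 _ _ (t , s₁ , s₂) (b≉ , a₁≈ , a₂≉) =
    TK.translate-≉ t b≉ , TF.translate-≈ s₁ a₁≈ , TF.translate-≉ s₂ a₂≉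
  R-translate (c5 β _) u v z (uNv , ¬uR₃v) =
    N-translate β u v z uNv , λ R₃ → ¬uR₃v (R₃-untranslate u v z R₃)

theorem4p4 : {q : ℕ} → IsPrimePower q → IsPrimePower (suc q) →
    (F : FiniteField q) → (K : FiniteField (suc q)) →
    (φ : Inverse (FiniteField.setoid K) (setoid (FiniteField.setoid F))) →
    Pointwise (FiniteField._≈_ F) (Inverse.to φ (FiniteField.0# K)) nothing →
    (i : Scheme.Class F K φ) → (u v z : Scheme.X F K φ) →
    Scheme.R F K φ i u v →
    Scheme.R F K φ i (Scheme._⊕_ F K φ u z) (Scheme._⊕_ F K φ v z)
theorem4p4 _ _ F K φ _ = SchemeTranslation.R-translate F K φ
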